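{- Let $M$ be a $3$-valent map and let $F$ be a face of $M$. Then: (i) the permutation induced by the side movement $sm(M,F)$ on the set of side edges of $M$ is even (has signature $1$); (ii) the signature of the permutation induced by $sm(M,F)$ on the set $V(M)$ of vertices equals the signature of the permutation induced by $sm(M,F)$ on the set $E(M)$ of edges.
   Context: A $3$-valent map $M$ is a cellularly embedded $3$-regular graph on a surface; $V(M)$, $E(M)$, $Face(M)$ denote its vertices, edges and faces. Throughout, every face boundary is a simple cycle, every edge lies in two distinct faces, and the three faces at any vertex are pairwise distinct. A corner is a pair $(F,v)$ with $v$ a vertex of the face $F$; a side edge is a pair $(F,e)$ with $e$ an edge of the face $F$. Side movement: let $F$ have boundary cycle $v_1,\dots,v_p$ (indices mod $p$, in a chosen direction), with edges $e_i=v_iv_{i+1}$, and let $G_i$ be the face other than $F$ containing $e_i$ (so the faces at $v_i$ are $F,G_{i-1},G_i$). The side movement $sm(M,F)$ is the permutation of corners and side edges given by $(F,v_i)\mapsto(F,v_{i+1})$, $(G_{i-1},v_i)\mapsto(G_i,v_{i+1})$, $(G_i,v_i)\mapsto(G_{i+1},v_{i+1})$, $(F,e_i)\mapsto(F,e_{i+1})$, $(G_i,e_i)\mapsto(G_{i+1},e_{i+1})$, fixing all other corners and side edges (a rotation of the face $F$ together with the adjacent layer, as in the Rubik's cube). It induces permutations of the vertices ($v_i\mapsto v_{i+1}$) and edges ($e_i\mapsto e_{i+1}$), fixing the others. -}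

module Defs where

open import Data.Nat using (ℕ; zero; suc; _≤_; _<?_)
open import Data.Fin using (Fin; zero; suc; toℕ; fromℕ<; _≟_)
open import Data.Fin.Properties using (any?)
open import Data.Product using (Σ; ∃; _×_; _,_; proj₁; proj₂)
open import Data.Product.Properties using (≡-dec)
open import Data.Sum using (_⊎_)
open import Data.Bool using (Bool; T)
open import Data.Bool.Properties using (T-irrelevant)
open import Data.List using (List; []; _∷_; length)
open import Data.Sign using (Sign; opposite) renaming (+ to plus)
open import Relation.Nullary using (Dec; yes; no; ¬_)
open import Relation.Nullary.Decidable using (⌊_⌋; fromWitness)
open import Relation.Binary.Definitions using (DecidableEquality)
open import Relation.Binary.PropositionalEquality using (_≡_; _≢_; refl; cong)
open import Relation.Binary.Construct.Closure.ReflexiveTransitive using (Star)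
open import Function.Definitions using (Injective)
open import Function.Bundles using (_⇔_; Equivalence)

next : ∀ {n} → Fin n → Fin n
next {suc m} i with toℕ i <? m
... | yes p = suc (fromℕ< p)
... | no _  = zero

-- Signature of a permutation of a type with decidable equality,
-- via decompositions into transpositions:
-- sgn σ = (-1)^k whenever σ is a product of k transpositions.

module _ {A : Set} (_≟A_ : DecidableEquality A) where

  swap : A → A → A → A
  swap a b x with x ≟A a
  ... | yes _ = b
  ... | no _ with x ≟A b
  ...   | yes _ = a
  ...   | no _  = x

  Transposition : Set
  Transposition = Σ (A × A) (λ p → proj₁ p ≢ proj₂ p)

  compose : List Transposition → A → A
  compose []                  x = x
  compose (((a , b) , _) ∷ ts) x = swap a b (compose ts x)

  signOfLength : ℕ → Sign
  signOfLength zero    = plus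
  signOfLength (suc k) = opposite (signOfLength k)

  HasSignature : (A → A) → Sign → Set
  HasSignature σ s = Σ (List Transposition) λ ts →
    (signOfLength (length ts) ≡ s) × (∀ x → σ x ≡ compose ts x)

-- A face f is a 2-cell whose
-- boundary is the simple cycle bv f 0, be f 0, bv f 1, ..., be f (len f - 1)
-- (indices mod len f), with be f i joining bv f i and bv f (i+1).
-- The surface is obtained by gluing the faces along their boundaries.

record Map3 : Set₁ where
  field
    nV nE nF : ℕ
    ends      : Fin nE → Fin nV × Fin nV
    loopless  : ∀ e → proj₁ (ends e) ≢ proj₂ (ends e)
    star      : Fin nV → Fin 3 → Fin nE
    star-inj  : ∀ v → Injective _≡_ _≡_ (star v)
    star-spec : ∀ v e → ((proj₁ (ends e) ≡ v ⊎ proj₂ (ends e) ≡ v) ⇔ ∃ λ k → star v k ≡ e)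
    connected : ∀ u w → Star (λ x y → ∃ λ e → ends e ≡ (x , y) ⊎ ends e ≡ (y , x)) u w
    len       : Fin nF → ℕ
    len≥2     : ∀ f → 2 ≤ len f
    bv        : (f : Fin nF) → Fin (len f) → Fin nV
    bv-inj    : ∀ f → Injective _≡_ _≡_ (bv f)
    be        : (f : Fin nF) → Fin (len f) → Fin nE
    be-inj    : ∀ f → Injective _≡_ _≡_ (be f)
    be-ends   : ∀ f i → ends (be f i) ≡ (bv f i , bv f (next i))
                      ⊎ ends (be f i) ≡ (bv f (next i) , bv f i)
    edgeFaces      : Fin nE → Fin 2 → Fin nF
    edgeFaces-inj  : ∀ e → Injective _≡_ _≡_ (edgeFaces e)
    edgeFaces-spec : ∀ e f → ((∃ λ i → be f i ≡ e) ⇔ ∃ λ k → edgeFaces e k ≡ f)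
    vertexFaces      : Fin nV → Fin 3 → Fin nF
    vertexFaces-inj  : ∀ v → Injective _≡_ _≡_ (vertexFaces v)
    vertexFaces-spec : ∀ v f → ((∃ λ i → bv f i ≡ v) ⇔ ∃ λ k → vertexFaces v k ≡ f)

module _ (M : Map3) where
  open Map3 M

  Vertex Edge Face : Set
  Vertex = Fin nV
  Edge   = Fin nE
  Face   = Fin nF

  edgeOf : Face → Edge → Bool
  edgeOf f e = ⌊ any? (λ i → be f i ≟ e) ⌋

  SideEdge : Set
  SideEdge = Σ (Face × Edge) (λ p → T (edgeOf (proj₁ p) (proj₂ p)))

  _≟SE_ : DecidableEquality SideEdge
  (p , s) ≟SE (q , t) with ≡-dec _≟_ _≟_ p q
  ... | no ¬eq = no (λ eq → ¬eq (cong proj₁ eq))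
  ... | yes refl with T-irrelevant s t
  ...   | refl = yes refl

  otherFace : Edge → Face → Face
  otherFace e f with edgeFaces e zero ≟ f
  ... | yes _ = edgeFaces e (suc zero)
  ... | no _  = edgeFaces e zero

  private
    edgeFaces-has : ∀ e k → T (edgeOf (edgeFaces e k) e)
    edgeFaces-has e k = fromWitness (Equivalence.from (edgeFaces-spec e (edgeFaces e k)) (k , refl))

    otherFace-has : ∀ e f → T (edgeOf (otherFace e f) e)
    otherFace-has e f with edgeFaces e zero ≟ f
    ... | yes _ = edgeFaces-has e (suc zero)
    ... | no _  = edgeFaces-has e zero

    boundary-has : ∀ f i → T (edgeOf f (be f i))
    boundary-has f i = fromWitness (i , refl)

  -- Side movement sm(M,F), with F's boundary v_i = bv F i, e_i = be F i
  -- and G_i = otherFace e_i F.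

  -- permutation induced on side edges:
  -- (F,e_i) ↦ (F,e_{i+1}),  (G_i,e_i) ↦ (G_{i+1},e_{i+1}),  others fixed
  smSideEdge : Face → SideEdge → SideEdge
  smSideEdge F ((h , e) , p) with any? (λ i → be F i ≟ e)
  ... | no _ = ((h , e) , p)
  ... | yes (i , _) with h ≟ F
  ...   | yes _ = ((F , be F (next i)) , boundary-has F (next i))
  ...   | no _ with h ≟ otherFace (be F i) F
  ...     | yes _ = ((otherFace (be F (next i)) F , be F (next i))
                    , otherFace-has (be F (next i)) F)
  ...     | no _  = ((h , e) , p)

  smVertex : Face → Vertex → Vertex
  smVertex F v with any? (λ i → bv F i ≟ v)
  ... | yes (i , _) = bv F (next i)
  ... | no _        = v

  smEdge : Face → Edge → Edge
  smEdge F e with any? (λ i → be F i ≟ e)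
  ... | yes (i , _) = be F (next i)
  ... | no _        = e

{-# OPTIONS --safe #-}
-- The side movement of F cycles the boundary vertices v₀ → v₁ → ⋯ and the
-- boundary edges e₀ → e₁ → ⋯ of F, so on vertices and on edges it is a
-- single p-cycle, of signature (-1)^(p-1) in both cases.  On side edges it
-- is the product of two disjoint p-cycles, (F,e₀) → (F,e₁) → ⋯ and
-- (G₀,e₀) → (G₁,e₁) → ⋯, hence even.  A p-cycle is a product of p - 1
-- transpositions: (g₀ g₁ ⋯ g_{p-1}) = (g₀ g₁) ∘ (g₁ ⋯ g_{p-1}).
module Submission where

open import Defs
open import Data.Nat using (ℕ; zero; suc; pred; _+_; s<s; s<s⁻¹)
open import Data.Nat.Properties using (_<?_)
open import Data.Fin using (Fin; zero; suc; toℕ; _≟_)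
open import Data.Fin.Properties using (any?; 0≢1+n; suc-injective)
open import Data.Product using (Σ; _×_; _,_; proj₁; proj₂; curry)
open import Data.List using ([]; _∷_; length; _++_)
open import Data.List.Properties using (length-++)
open import Data.Sign using (Sign; opposite; _*_) renaming (+ to plus; - to minus)
open import Data.Sign.Properties using (s*s≡+; *-assoc)
open import Data.Bool using (T)
open import Data.Bool.Properties using (T-irrelevant)
open import Function using (_∘_; id)
open import Function.Bundles using (Equivalence)
open import Function.Definitions using (Injective)
open import Relation.Nullary using (yes; no; contradiction)
open import Relation.Nullary.Decidable using (fromWitness)
open import Relation.Binary.Definitions using (DecidableEquality)
open import Relation.Binary.PropositionalEquality
  using (_≡_; _≢_; _≗_; refl; sym; trans; cong; cong₂; subst; module ≡-Reasoning)

next-suc : ∀ {m} (j : Fin (suc m)) → next j ≢ zero → next {suc (suc m)} (suc j) ≡ suc (next j)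
next-suc {m} j next≢0 with toℕ j <? m | suc (toℕ j) <? suc m
... | yes _ | yes _  = refl
... | yes p | no ¬q  = contradiction (s<s p) ¬q
... | no _  | _      = contradiction refl next≢0

next-suc-wrap : ∀ {m} (j : Fin (suc m)) → next j ≡ zero → next {suc (suc m)} (suc j) ≡ zero
next-suc-wrap {m} j with toℕ j <? m | suc (toℕ j) <? suc m
... | yes _ | _      = λ ()
... | no ¬p | yes q  = contradiction (s<s⁻¹ q) ¬p
... | no _  | no _   = λ _ → refl

signOfLength-irrelevant : ∀ {A B : Set} (_≟A_ : DecidableEquality A) (_≟B_ : DecidableEquality B) k →
                          signOfLength _≟A_ k ≡ signOfLength _≟B_ k
signOfLength-irrelevant _ _ zero    = refl
signOfLength-irrelevant d d′ (suc k) = cong opposite (signOfLength-irrelevant d d′ k)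

module _ {A : Set} (_≟A_ : DecidableEquality A) where

  swap-left : ∀ a b → swap _≟A_ a b a ≡ b
  swap-left a b with a ≟A a
  ... | yes _  = refl
  ... | no a≢a = contradiction refl a≢a

  swap-right : ∀ a b → swap _≟A_ a b b ≡ a
  swap-right a b with b ≟A a
  ... | yes b≡a = b≡a
  ... | no _ with b ≟A b
  ...   | yes _  = refl
  ...   | no b≢b = contradiction refl b≢b

  swap-fixes : ∀ {a b x} → x ≢ a → x ≢ b → swap _≟A_ a b x ≡ x
  swap-fixes {a} {b} {x} x≢a x≢b with x ≟A a
  ... | yes x≡a = contradiction x≡a x≢a
  ... | no _ with x ≟A b
  ...   | yes x≡b = contradiction x≡b x≢b
  ...   | no _    = refl

  compose-++ : ∀ ts us → compose _≟A_ (ts ++ us) ≗ compose _≟A_ ts ∘ compose _≟A_ us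
  compose-++ []                  us x = refl
  compose-++ (((a , b) , _) ∷ ts) us x = cong (swap _≟A_ a b) (compose-++ ts us x)

  signOfLength-+ : ∀ m n → signOfLength _≟A_ (m + n) ≡ signOfLength _≟A_ m * signOfLength _≟A_ n
  signOfLength-+ zero    n = refl
  signOfLength-+ (suc m) n =
    trans (cong opposite (signOfLength-+ m n)) (sym (*-assoc minus (signOfLength _≟A_ m) (signOfLength _≟A_ n)))

  hasSignature-id : HasSignature _≟A_ id plus
  hasSignature-id = [] , refl , λ _ → refl

  hasSignature-≗ : ∀ {σ τ s} → σ ≗ τ → HasSignature _≟A_ σ s → HasSignature _≟A_ τ s
  hasSignature-≗ σ≗τ (ts , sign , σ≗ts) = ts , sign , λ x → trans (sym (σ≗τ x)) (σ≗ts x)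

  hasSignature-swap∘ : ∀ {σ s a b} → a ≢ b → HasSignature _≟A_ σ s →
                       HasSignature _≟A_ (swap _≟A_ a b ∘ σ) (opposite s)
  hasSignature-swap∘ {a = a} {b} a≢b (ts , sign , σ≗ts) =
    ((a , b) , a≢b) ∷ ts , cong opposite sign , λ x → cong (swap _≟A_ a b) (σ≗ts x)

  hasSignature-∘ : ∀ {σ τ s t} → HasSignature _≟A_ σ s → HasSignature _≟A_ τ t →
                   HasSignature _≟A_ (σ ∘ τ) (s * t)
  hasSignature-∘ {σ} {τ} {s} {t} (ts , sign-ts , σ≗ts) (us , sign-us , τ≗us) =
    ts ++ us , sign , composition
    where
    open ≡-Reasoning
    sign : signOfLength _≟A_ (length (ts ++ us)) ≡ s * t
    sign = begin
      signOfLength _≟A_ (length (ts ++ us))                   ≡⟨ cong (signOfLength _≟A_) (length-++ ts) ⟩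
      signOfLength _≟A_ (length ts + length us)               ≡⟨ signOfLength-+ (length ts) (length us) ⟩
      signOfLength _≟A_ (length ts) * signOfLength _≟A_ (length us) ≡⟨ cong₂ _*_ sign-ts sign-us ⟩
      s * t                                                   ∎
    composition : ∀ x → σ (τ x) ≡ compose _≟A_ (ts ++ us) x
    composition x = begin
      σ (τ x)                                    ≡⟨ σ≗ts (τ x) ⟩
      compose _≟A_ ts (τ x)                      ≡⟨ cong (compose _≟A_ ts) (τ≗us x) ⟩
      compose _≟A_ ts (compose _≟A_ us x)        ≡⟨ compose-++ ts us x ⟨
      compose _≟A_ (ts ++ us) x                  ∎

  cycle : ∀ {n} → (Fin n → A) → A → A
  cycle g x with any? (λ i → g i ≟A x)
  ... | yes (i , _) = g (next i)
  ... | no _        = x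

  cycle-apply : ∀ {n} (g : Fin n → A) → Injective _≡_ _≡_ g → ∀ i → cycle g (g i) ≡ g (next i)
  cycle-apply g inj i with any? (λ j → g j ≟A g i)
  ... | yes (j , gj≡gi) = cong (g ∘ next) (inj gj≡gi)
  ... | no gi∉g         = contradiction (i , refl) gi∉g

  cycle-fixes : ∀ {n} (g : Fin n → A) {x} → (∀ i → g i ≢ x) → cycle g x ≡ x
  cycle-fixes g {x} x∉g with any? (λ i → g i ≟A x)
  ... | yes (i , gi≡x) = contradiction gi≡x (x∉g i)
  ... | no _           = refl

  cycle-singleton : (g : Fin 1 → A) → cycle g ≗ id
  cycle-singleton g x with any? (λ i → g i ≟A x)
  ... | yes (zero , gi≡x) = gi≡x
  ... | no _              = refl

  cycle-suc : ∀ {m} (g : Fin (suc (suc m)) → A) → Injective _≡_ _≡_ g →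
              swap _≟A_ (g zero) (g (suc zero)) ∘ cycle (g ∘ suc) ≗ cycle g
  cycle-suc g inj x with any? (λ i → g i ≟A x)
  ... | no x∉g = trans (cong (swap _≟A_ _ _) (cycle-fixes (g ∘ suc) (gi≢x ∘ suc)))
                       (swap-fixes (gi≢x zero ∘ sym) (gi≢x (suc zero) ∘ sym))
    where
    gi≢x : ∀ i → g i ≢ x
    gi≢x = curry x∉g
  ... | yes (zero , refl) =
    trans (cong (swap _≟A_ _ _) (cycle-fixes (g ∘ suc) (λ i → 0≢1+n ∘ sym ∘ inj))) (swap-left _ _)
  ... | yes (suc j , refl) with next j ≟ zero
  ...   | yes next≡0 =
    trans (cong (swap _≟A_ _ _) (trans (cycle-apply (g ∘ suc) (suc-injective ∘ inj) j) (cong (g ∘ suc) next≡0)))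
          (trans (swap-right _ _) (cong g (sym (next-suc-wrap j next≡0))))
  ...   | no next≢0 =
    trans (cong (swap _≟A_ _ _) (cycle-apply (g ∘ suc) (suc-injective ∘ inj) j))
          (trans (swap-fixes (0≢1+n ∘ sym ∘ inj) (next≢0 ∘ suc-injective ∘ inj))
                 (cong g (sym (next-suc j next≢0))))

  cycle-hasSignature : ∀ {n} (g : Fin n → A) → Injective _≡_ _≡_ g →
                       HasSignature _≟A_ (cycle g) (signOfLength _≟A_ (pred n))
  cycle-hasSignature {zero}        g _   = hasSignature-≗ (λ _ → sym (cycle-fixes g (λ ()))) hasSignature-id
  cycle-hasSignature {suc zero}    g _   = hasSignature-≗ (sym ∘ cycle-singleton g) hasSignature-id
  cycle-hasSignature {suc (suc m)} g inj =
    hasSignature-≗ (cycle-suc g inj)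
      (hasSignature-swap∘ (0≢1+n ∘ inj) (cycle-hasSignature (g ∘ suc) (suc-injective ∘ inj)))

module SideMovement (M : Map3) (F : Face M) where
  open Map3 M

  p : ℕ
  p = len F

  G : Fin p → Face M
  G i = otherFace M (be F i) F

  otherFace≢ : ∀ e → otherFace M e F ≢ F
  otherFace≢ e with edgeFaces e zero ≟ F
  ... | yes e₀≡F = λ e₁≡F → 0≢1+n (edgeFaces-inj e (trans e₀≡F (sym e₁≡F)))
  ... | no e₀≢F  = e₀≢F

  edgeOf-edgeFaces : ∀ e k → T (edgeOf M (edgeFaces e k) e)
  edgeOf-edgeFaces e k = fromWitness (Equivalence.from (edgeFaces-spec e (edgeFaces e k)) (k , refl))

  edgeOf-otherFace : ∀ e f → T (edgeOf M (otherFace M e f) e)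
  edgeOf-otherFace e f with edgeFaces e zero ≟ f
  ... | yes _ = edgeOf-edgeFaces e (suc zero)
  ... | no _  = edgeOf-edgeFaces e zero

  face : SideEdge M → Face M
  face = proj₁ ∘ proj₁

  edge : SideEdge M → Edge M
  edge = proj₂ ∘ proj₁

  sideEdge-≡ : ∀ {x y : SideEdge M} → face x ≡ face y → edge x ≡ edge y → x ≡ y
  sideEdge-≡ {(_ , s)} {(_ , t)} refl refl = cong (_ ,_) (T-irrelevant s t)

  sideF sideG : Fin p → SideEdge M
  sideF i = (F , be F i) , fromWitness (i , refl)
  sideG i = (G i , be F i) , edgeOf-otherFace (be F i) F

  sideF-injective : Injective _≡_ _≡_ sideF
  sideF-injective = be-inj F ∘ cong edge

  sideG-injective : Injective _≡_ _≡_ sideG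
  sideG-injective = be-inj F ∘ cong edge

  smVertex-cycle : smVertex M F ≗ cycle _≟_ (bv F)
  smVertex-cycle v with any? (λ i → bv F i ≟ v)
  ... | yes _ = refl
  ... | no _  = refl

  smEdge-cycle : smEdge M F ≗ cycle _≟_ (be F)
  smEdge-cycle e with any? (λ i → be F i ≟ e)
  ... | yes _ = refl
  ... | no _  = refl

  rotF rotG : SideEdge M → SideEdge M
  rotF = cycle (_≟SE_ M) sideF
  rotG = cycle (_≟SE_ M) sideG

  smSideEdge-cycles : smSideEdge M F ≗ rotF ∘ rotG
  smSideEdge-cycles x@((h , e) , _) with any? (λ i → be F i ≟ e)
  ... | no e∉F = sym (trans (cong rotF (cycle-fixes (_≟SE_ M) sideG (λ i → off-F i refl)))
                            (cycle-fixes (_≟SE_ M) sideF (λ i → off-F i refl)))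
    where
    off-F : ∀ i {y} → edge y ≡ be F i → y ≢ x
    off-F i edge≡ y≡x = e∉F (i , trans (sym edge≡) (cong edge y≡x))
  ... | yes (i , refl) with h ≟ F
  ...   | yes refl = sym (begin
    rotF (rotG x)       ≡⟨ cong rotF (cycle-fixes (_≟SE_ M) sideG (λ j → otherFace≢ (be F j) ∘ cong face)) ⟩
    rotF x              ≡⟨ cong rotF (sideEdge-≡ refl refl) ⟩
    rotF (sideF i)      ≡⟨ cycle-apply (_≟SE_ M) sideF sideF-injective i ⟩
    sideF (next i)      ∎)
    where open ≡-Reasoning
  ...   | no h≢F with h ≟ G i
  ...     | yes refl = sym (trans (begin
    rotF (rotG x)         ≡⟨ cong (rotF ∘ rotG) (sideEdge-≡ refl refl) ⟩
    rotF (rotG (sideG i)) ≡⟨ cong rotF (cycle-apply (_≟SE_ M) sideG sideG-injective i) ⟩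
    rotF (sideG (next i)) ≡⟨ cycle-fixes (_≟SE_ M) sideF (λ j → otherFace≢ (be F (next i)) ∘ sym ∘ cong face) ⟩
    sideG (next i)        ∎) (sideEdge-≡ refl refl))
    where open ≡-Reasoning
  ...     | no h≢G = sym (trans (cong rotF (cycle-fixes (_≟SE_ M) sideG not-sideG))
                                (cycle-fixes (_≟SE_ M) sideF (λ j → h≢F ∘ sym ∘ cong face)))
    where
    not-sideG : ∀ j → sideG j ≢ x
    not-sideG j sideG≡x = h≢G (trans (sym (cong face sideG≡x)) (cong G (be-inj F (cong edge sideG≡x))))

  smSideEdge-even : HasSignature (_≟SE_ M) (smSideEdge M F) plus
  smSideEdge-even =
    subst (HasSignature (_≟SE_ M) _) (s*s≡+ (signOfLength (_≟SE_ M) (pred p)))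
      (hasSignature-≗ (_≟SE_ M) (sym ∘ smSideEdge-cycles)
        (hasSignature-∘ (_≟SE_ M) (cycle-hasSignature (_≟SE_ M) sideF sideF-injective)
                                  (cycle-hasSignature (_≟SE_ M) sideG sideG-injective)))

  smVertex-hasSignature : HasSignature _≟_ (smVertex M F) (signOfLength (_≟_ {nV}) (pred p))
  smVertex-hasSignature = hasSignature-≗ _≟_ (sym ∘ smVertex-cycle) (cycle-hasSignature _≟_ (bv F) (bv-inj F))

  smEdge-hasSignature : HasSignature _≟_ (smEdge M F) (signOfLength (_≟_ {nV}) (pred p))
  smEdge-hasSignature =
    subst (HasSignature _≟_ _) (signOfLength-irrelevant (_≟_ {nE}) (_≟_ {nV}) (pred p))
      (hasSignature-≗ _≟_ (sym ∘ smEdge-cycle) (cycle-hasSignature _≟_ (be F) (be-inj F)))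

lemma1 : (M : Map3) (F : Face M) →
    HasSignature (_≟SE_ M) (smSideEdge M F) plus
    × Σ Sign (λ s → HasSignature _≟_ (smVertex M F) s × HasSignature _≟_ (smEdge M F) s)
lemma1 M F = smSideEdge-even , _ , smVertex-hasSignature , smEdge-hasSignature
  where open SideMovement M F
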